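{- Let $(x,y)\in\mathcal{I}$ and let $S,T\subseteq V$ be tight valid sets with $S\cap T\cap R\neq\emptyset$. Then $S\cap T$ and $S\cup T$ are also tight valid sets.
   Context: $G=(V,E)$ undirected graph with terminals $R\subseteq V$. $D=(V,A)$ has arcs $(u,v),(v,u)$ for each edge $uv$. Fix root $r\in R$; $U\subseteq V$ is valid if $U\cap R\ne\emptyset$ and $r\notin U$; $\delta^+(U)$ = arcs leaving $U$. A full component is a tree in $G$ whose leaves are terminals and internal vertices non-terminals; orienting it towards a terminal (sink) gives a directed full component, sources being the other terminals; $\mathcal{K}$ is the set of these. For $U\subseteq V$, $\Delta^+(U)$ is the set of $K\in\mathcal{K}$ whose sink is not in $U$ and which have a source in $U$. $\mathcal{I}=\{(x,y)\in\mathbb{R}^A_{\ge0}\times\mathbb{R}^{\mathcal{K}}_{\ge0}: x(\delta^+(U))+y(\Delta^+(U))\ge1\ \forall\text{ valid }U\subseteq V\}$, where $x(S)=\sum_{j\in S}x_j$. A valid set is tight for $(x,y)$ if its constraint holds with equality. -}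

module Defs where

open import Level using (Level; _⊔_) renaming (suc to lsuc)
open import Algebra.Bundles using (CommutativeRing)
open import Relation.Binary.Core using (Rel)
open import Relation.Binary.Structures using (IsTotalOrder)
open import Data.Nat using (ℕ; zero; suc)
open import Data.Fin using (Fin; zero; suc; _≟_)
open import Data.Fin.Subset using (Subset; _∈_; _∉_; Nonempty; _∩_)
open import Data.Vec using (Vec; []; _∷_; lookup)
open import Data.Bool using (Bool; true; false; _∧_; _∨_; not; if_then_else_)
open import Data.Product using (Σ; ∃; _×_; _,_; proj₁; proj₂)
open import Data.Sum using (_⊎_)
open import Data.List using (List; []; _∷_)
open import Data.List.Relation.Unary.Unique.Propositional using (Unique)
open import Relation.Binary.PropositionalEquality using (_≡_; _≢_)
open import Relation.Nullary.Decidable using (⌊_⌋)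
open import Relation.Nullary using (¬_)

-- Scalars: an ordered commutative ring (ℝ is an instance).

record OrderedCommRing (c ℓ₁ ℓ₂ : Level) : Set (lsuc (c ⊔ ℓ₁ ⊔ ℓ₂)) where
  field
    commutativeRing : CommutativeRing c ℓ₁
  open CommutativeRing commutativeRing public
  infix 4 _≤_
  field
    _≤_          : Rel Carrier ℓ₂
    isTotalOrder : IsTotalOrder _≈_ _≤_
    +-monoˡ-≤    : ∀ {a b} (d : Carrier) → a ≤ b → a + d ≤ b + d
    *-nonneg     : ∀ {a b} → 0# ≤ a → 0# ≤ b → 0# ≤ a * b

anyFin : (k : ℕ) → (Fin k → Bool) → Bool
anyFin zero    f = false
anyFin (suc k) f = f zero ∨ anyFin k (λ i → f (suc i))

countFin : (k : ℕ) → (Fin k → Bool) → ℕ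
countFin zero    f = zero
countFin (suc k) f = (if f zero then suc zero else zero) Data.Nat.+ countFin k (λ i → f (suc i))
  where import Data.Nat

-- Graph G = (V, E): V = Fin n, E = Fin m, ends e = endpoints of edge e.
-- Arcs of D: (e , true) oriented proj₁ → proj₂, (e , false) reversed.

Graph : ℕ → ℕ → Set
Graph n m = Fin m → Fin n × Fin n

Arc : ℕ → Set
Arc m = Fin m × Bool

module _ {n m : ℕ} (ends : Graph n m) where

  tail : Arc m → Fin n
  tail (e , true)  = proj₁ (ends e)
  tail (e , false) = proj₂ (ends e)

  head : Arc m → Fin n
  head (e , true)  = proj₂ (ends e)
  head (e , false) = proj₁ (ends e)

  endpointB : Fin m → Fin n → Bool
  endpointB e v = ⌊ proj₁ (ends e) ≟ v ⌋ ∨ ⌊ proj₂ (ends e) ≟ v ⌋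

  -- subgraphs are given by edge sets F : Subset m; V(F) = incident vertices
  Incident : Subset m → Fin n → Set
  Incident F v = ∃ λ e → e ∈ F × (proj₁ (ends e) ≡ v ⊎ proj₂ (ends e) ≡ v)

  incidentB : Subset m → Fin n → Bool
  incidentB F v = anyFin m (λ e → lookup F e ∧ endpointB e v)

  deg : Subset m → Fin n → ℕ
  deg F v = countFin m (λ e → lookup F e ∧ endpointB e v)

  Step : Fin m → Fin n → Fin n → Set
  Step e u w = ends e ≡ (u , w) ⊎ ends e ≡ (w , u)

  data Walk (F : Subset m) : Fin n → Fin n → Set where
    []   : ∀ {u} → Walk F u u
    step : ∀ {u w v} (e : Fin m) → e ∈ F → Step e u w → Walk F w v → Walk F u v

  walkEdges : ∀ {F u v} → Walk F u v → List (Fin m)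
  walkEdges []              = []
  walkEdges (step e _ _ w)  = e ∷ walkEdges w

  Connected : Subset m → Set
  Connected F = ∀ u v → Incident F u → Incident F v → Walk F u v

  Acyclic : Subset m → Set
  Acyclic F = ∀ u (w : Walk F u u) → Unique (walkEdges w) → walkEdges w ≡ []

  IsTree : Subset m → Set
  IsTree F = Nonempty F × Connected F × Acyclic F

  module _ (R : Subset n) where

    IsFullComponent : Subset m → Set
    IsFullComponent F = IsTree F ×
      (∀ v → Incident F v → (deg F v ≡ 1 → v ∈ R) × (deg F v ≢ 1 → v ∉ R))

    -- directed full component: full component F oriented towards sink s (a terminal of F)
    IsDFC : Subset m → Fin n → Set
    IsDFC F s = IsFullComponent F × s ∈ R × Incident F s

    -- K = (F , s) ∈ Δ⁺(U): sink not in U, and some source (terminal of F other than s) in U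
    inΔ⁺ : Subset n → Subset m → Fin n → Bool
    inΔ⁺ U F s = not (lookup U s) ∧
      anyFin n (λ v → lookup U v ∧ lookup R v ∧ not ⌊ v ≟ s ⌋ ∧ incidentB F v)

    Valid : Fin n → Subset n → Set
    Valid r U = Nonempty (U ∩ R) × r ∉ U

module _ {c ℓ₁ ℓ₂} (𝕆 : OrderedCommRing c ℓ₁ ℓ₂) where
  open OrderedCommRing 𝕆 using (Carrier; _+_; _≈_; _≤_; 0#; 1#)

  sumFin : (k : ℕ) → (Fin k → Carrier) → Carrier
  sumFin zero    f = 0#
  sumFin (suc k) f = f zero + sumFin k (λ i → f (suc i))

  sumSubset : (k : ℕ) → (Subset k → Carrier) → Carrier
  sumSubset zero    f = f []
  sumSubset (suc k) f = sumSubset k (λ s → f (false ∷ s)) + sumSubset k (λ s → f (true ∷ s))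

  module _ {n m : ℕ} (ends : Graph n m) (R : Subset n) (r : Fin n)
           (x : Arc m → Carrier) (y : Subset m → Fin n → Carrier) where

    xδ⁺ : Subset n → Carrier
    xδ⁺ U = sumFin m (λ e → term (e , true) + term (e , false))
      where
        term : Arc m → Carrier
        term a = if lookup U (tail ends a) ∧ not (lookup U (head ends a)) then x a else 0#

    -- y(Δ⁺(U)); y is indexed by pairs (F , s) and vanishes off 𝒦
    yΔ⁺ : Subset n → Carrier
    yΔ⁺ U = sumSubset m (λ F → sumFin n (λ s → if inΔ⁺ ends R U F s then y F s else 0#))

    InI : Set (ℓ₁ ⊔ ℓ₂)
    InI = (∀ a → 0# ≤ x a)
        × (∀ F s → IsDFC ends R F s → 0# ≤ y F s)
        × (∀ F s → ¬ IsDFC ends R F s → y F s ≈ 0#)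
        × (∀ U → Valid ends R r U → 1# ≤ xδ⁺ U + yΔ⁺ U)

    TightValid : Subset n → Set ℓ₁
    TightValid U = Valid ends R r U × (xδ⁺ U + yΔ⁺ U ≈ 1#)

-- The cut function f U = x(δ⁺(U)) + y(Δ⁺(U)) is submodular: it is a nonnegative combination of the
-- indicators "arc a, resp. directed full component K, leaves U", and leaving U means that the head
-- (sink) lies outside U while the tail (some source) lies in U; the latter condition is monotone
-- and preserves unions. For tight S and T the constraints at S ∩ T and S ∪ T then give
-- 2 ≤ f (S ∩ T) + f (S ∪ T) ≤ f S + f T = 2, so both are tight.
-- The LP only says y ≥ 0 on directed full components and y = 0 elsewhere, so constructively one
-- must decide being a directed full component: connectivity and acyclicity are decided by bounded
-- search, since walks shorten to paths with fewer than n edges and cycles have distinct edges.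
module Submission where

open import Defs
open import Data.Nat as ℕ using (ℕ; zero; suc; z≤n; s≤s; s<s)
open import Data.Fin using (Fin; zero; suc; _<_) renaming (_≟_ to _≟ᶠ_)
open import Data.Fin.Subset using (Subset; _∈_; _∉_; _∩_; _∪_; Nonempty)
open import Algebra.Bundles using (CommutativeMonoid)
import Algebra.Properties.CommutativeSemigroup as CommutativeSemigroupProperties
import Algebra.Properties.Monoid.Mult as MonoidMultProperties
open import Data.Bool using (Bool; true; false; _∧_; _∨_; not; T; if_then_else_)
open import Data.Bool.Properties using (T-∧; T-∨; ∧-comm; ∧-distribʳ-∨; ∨-commutativeMonoid)
open import Data.Empty using (⊥-elim)
open import Data.Fin.Properties using (any?; all?; pigeonhole)
open import Data.Fin.Subset.Properties using (_∈?_; nonempty?; ∩-assoc; p∩q⊆p; p⊆p∪q; x∈p∪q⁻; x∈p∩q⁺; x∈p∩q⁻)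
open import Data.List using (List; []; _∷_; length; lookup)
open import Data.List.Membership.Propositional.Properties using (∈-lookup)
open import Data.List.Properties using () renaming (≡-dec to ≡-decᴸ)
open import Data.List.Relation.Unary.All as All using (All)
open import Data.List.Relation.Unary.All.Properties using (¬Any⇒All¬)
open import Data.List.Relation.Unary.Any using (here; there)
open import Data.List.Relation.Unary.AllPairs as AllPairs using (_∷_)
open import Data.List.Relation.Unary.Unique.Propositional using (Unique)
open import Data.List.Relation.Unary.Unique.DecPropositional using (unique?)
open import Data.Nat.Properties as ℕₚ using (≰⇒>; <⇒≤)
open import Data.Product using (Σ; _×_; _,_; proj₁; proj₂; map₁)
open import Data.Product.Properties using () renaming (≡-dec to ≡-decˣ)
open import Data.Sum as Sum using ([_,_])
open import Data.Unit using (⊤; tt)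
open import Data.Vec using (_∷_) renaming (lookup to lookupᵛ)
open import Data.Vec.Properties using (lookup-zipWith)
open import Function using (_∘_; Equivalence)
open import Relation.Binary.Bundles using (Poset)
open import Relation.Binary.Structures using (IsTotalOrder)
open import Relation.Nullary using (Dec; yes; no; ¬_; contradiction)
open import Relation.Nullary.Decidable using (_×-dec_; _⊎-dec_; _→-dec_; ¬?; map′)
open import Relation.Binary.PropositionalEquality using (_≡_; _≢_; refl; sym; trans; cong; cong₂; subst; subst₂)
import Data.List.Membership.DecPropositional as DecMembership
import Relation.Binary.Reasoning.PartialOrder as PosetReasoning

unique-lookup-injective : ∀ {A : Set} {xs : List A} → Unique xs →
                          ∀ {i j} → i < j → lookup xs i ≢ lookup xs j
unique-lookup-injective (x∉xs ∷ _)  {zero}  {suc j} _         = All.lookup x∉xs (∈-lookup j)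
unique-lookup-injective (_ ∷ xs!)   {suc i} {suc j} (s<s i<j) = unique-lookup-injective xs! i<j

unique⇒length≤ : ∀ {k} (xs : List (Fin k)) → Unique xs → length xs ℕ.≤ k
unique⇒length≤ {k} xs xs! with length xs ℕ.≤? k
... | yes ≤k = ≤k
... | no  ≰k = let i , j , i<j , same = pigeonhole (≰⇒> ≰k) (lookup xs)
               in contradiction same (unique-lookup-injective xs! i<j)

module Decidability {n m : ℕ} (ends : Graph n m) where
  open DecMembership (_≟ᶠ_ {n}) using () renaming (_∈_ to _∈ᴸ_; _∈?_ to _∈ᴸ?_)

  edges : ∀ {F u v} → Walk ends F u v → List (Fin m)
  edges = walkEdges ends

  vertices : ∀ {F u v} → Walk ends F u v → List (Fin n)
  vertices {u = u} []               = u ∷ []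
  vertices {u = u} (step _ _ _ w)   = u ∷ vertices w

  length-vertices : ∀ {F u v} (w : Walk ends F u v) → length (vertices w) ≡ suc (length (edges w))
  length-vertices []             = refl
  length-vertices (step _ _ _ w) = cong suc (length-vertices w)

  Path : Subset m → Fin n → Fin n → Set
  Path F u v = Σ (Walk ends F u v) λ w → Unique (vertices w)

  path-from : ∀ {F u v x} (p : Walk ends F u v) → Unique (vertices p) → x ∈ᴸ vertices p → Path F x v
  path-from []                  p!       (here refl) = [] , p!
  path-from p@(step _ _ _ _)    p!       (here refl) = p , p!
  path-from (step _ _ _ p)      (_ ∷ p!) (there x∈p) = path-from p p! x∈p

  walk⇒path : ∀ {F u v} → Walk ends F u v → Path F u v
  walk⇒path []                            = [] , (All.[] ∷ AllPairs.[])
  walk⇒path {u = u} (step e e∈F st w) with walk⇒path w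
  ... | p , p! with u ∈ᴸ? vertices p
  ...   | yes u∈p = path-from p p! u∈p
  ...   | no  u∉p = step e e∈F st p , (¬Any⇒All¬ (vertices p) u∉p ∷ p!)

  path-length< : ∀ {F u v} ((p , p!) : Path F u v) → length (edges p) ℕ.< n
  path-length< (p , p!) = subst (ℕ._≤ n) (length-vertices p) (unique⇒length≤ (vertices p) p!)

  ShortWalk : Subset m → ℕ → Fin n → Fin n → (List (Fin m) → Set) → Set
  ShortWalk F k u v P = Σ (Walk ends F u v) λ w → length (edges w) ℕ.≤ k × P (edges w)

  step? : ∀ e u w → Dec (Step ends e u w)
  step? e u w = ≡-decˣ _≟ᶠ_ _≟ᶠ_ (ends e) (u , w) ⊎-dec ≡-decˣ _≟ᶠ_ _≟ᶠ_ (ends e) (w , u)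

  shortWalk? : ∀ F k u v {P : List (Fin m) → Set} → (∀ l → Dec (P l)) → Dec (ShortWalk F k u v P)
  shortWalk? F zero u v P? with u ≟ᶠ v | P? []
  ... | yes refl | yes p  = yes ([] , z≤n , p)
  ... | yes refl | no ¬p  = no λ { ([] , _ , p) → ¬p p ; (step _ _ _ _ , () , _) }
  ... | no u≢v   | _      = no λ { ([] , _ , _) → u≢v refl ; (step _ _ _ _ , () , _) }
  shortWalk? F (suc k) u v P?
    with u ≟ᶠ v ×-dec P? []
       | any? (λ e → any? λ w → e ∈? F ×-dec step? e u w ×-dec shortWalk? F k w v (λ l → P? (e ∷ l)))
  ... | yes (refl , p) | _ = yes ([] , z≤n , p)
  ... | no _ | yes (e , w , e∈F , st , rest , ≤k , p) = yes (step e e∈F st rest , s≤s ≤k , p)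
  ... | no ¬empty | no ¬step = no λ
    { ([] , _ , p) → ¬empty (refl , p)
    ; (step {w = w} e e∈F st rest , s≤s ≤k , p) → ¬step (e , w , e∈F , st , rest , ≤k , p) }

  walk? : ∀ F u v → Dec (Walk ends F u v)
  walk? F u v = map′ proj₁ short (shortWalk? F n u v (λ _ → yes tt))
    where
      short : Walk ends F u v → ShortWalk F n u v (λ _ → ⊤)
      short w = let p , p! = walk⇒path w in p , <⇒≤ (path-length< (p , p!)) , tt

  incident? : ∀ F v → Dec (Incident ends F v)
  incident? F v = any? λ e → e ∈? F ×-dec (proj₁ (ends e) ≟ᶠ v ⊎-dec proj₂ (ends e) ≟ᶠ v)

  connected? : ∀ F → Dec (Connected ends F)
  connected? F = all? λ u → all? λ v → incident? F u →-dec (incident? F v →-dec walk? F u v)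

  Cycle : Subset m → Fin n → Set
  Cycle F u = ShortWalk F m u u (λ l → Unique l × l ≢ [])

  acyclic? : ∀ F → Dec (Acyclic ends F)
  acyclic? F = map′ noCycle⇒acyclic acyclic⇒noCycle
                 (all? λ u → ¬? (shortWalk? F m u u λ l → unique? _≟ᶠ_ l ×-dec ¬? (≡-decᴸ _≟ᶠ_ l [])))
    where
      noCycle⇒acyclic : (∀ u → ¬ Cycle F u) → Acyclic ends F
      noCycle⇒acyclic _       u []               _  = refl
      noCycle⇒acyclic noCycle u w@(step _ _ _ _) w! =
        ⊥-elim (noCycle u (w , unique⇒length≤ (edges w) w! , w! , λ ()))
      acyclic⇒noCycle : Acyclic ends F → ∀ u → ¬ Cycle F u
      acyclic⇒noCycle ac u (w , _ , w! , w≢[]) = w≢[] (ac u w w!)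

  isDFC? : ∀ R F s → Dec (IsDFC ends R F s)
  isDFC? R F s =
    ((nonempty? F ×-dec connected? F ×-dec acyclic? F) ×-dec
      all? (λ v → incident? F v →-dec
        ((deg ends F v ℕ.≟ 1 →-dec v ∈? R) ×-dec (¬? (deg ends F v ℕ.≟ 1) →-dec ¬? (v ∈? R)))))
    ×-dec s ∈? R ×-dec incident? F s

anyFin-cong : ∀ k {f g : Fin k → Bool} → (∀ i → f i ≡ g i) → anyFin k f ≡ anyFin k g
anyFin-cong zero    f≡g = refl
anyFin-cong (suc k) f≡g = cong₂ _∨_ (f≡g zero) (anyFin-cong k (f≡g ∘ suc))

anyFin-mono : ∀ k {f g : Fin k → Bool} → (∀ i → T (f i) → T (g i)) → T (anyFin k f) → T (anyFin k g)
anyFin-mono (suc k) f⇒g =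
  Equivalence.from T-∨ ∘ Sum.map (f⇒g zero) (anyFin-mono k (f⇒g ∘ suc)) ∘ Equivalence.to T-∨

anyFin-∨ : ∀ k (f g : Fin k → Bool) → anyFin k (λ i → f i ∨ g i) ≡ anyFin k f ∨ anyFin k g
anyFin-∨ zero    f g = refl
anyFin-∨ (suc k) f g =
  trans (cong ((f zero ∨ g zero) ∨_) (anyFin-∨ k (f ∘ suc) (g ∘ suc)))
        (∨-interchange (f zero) (g zero) (anyFin k (f ∘ suc)) (anyFin k (g ∘ suc)))
  where open CommutativeSemigroupProperties (CommutativeMonoid.commutativeSemigroup ∨-commutativeMonoid)
          renaming (interchange to ∨-interchange)

meets : ∀ {n} → Subset n → (Fin n → Bool) → Bool
meets {n} U φ = anyFin n (λ v → lookupᵛ U v ∧ φ v)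

T-∧-monoˡ : ∀ {a b c} → (T a → T b) → T (a ∧ c) → T (b ∧ c)
T-∧-monoˡ a⇒b = Equivalence.from T-∧ ∘ map₁ a⇒b ∘ Equivalence.to T-∧

count : Bool → ℕ
count true  = 1
count false = 0

count-mono : ∀ {a b} → (T a → T b) → count a ℕ.≤ count b
count-mono {false}         _   = z≤n
count-mono {true} {true}   _   = ℕₚ.≤-refl
count-mono {true} {false} a⇒b = ⊥-elim (a⇒b tt)

count-∨ : ∀ a b → count (a ∨ b) ℕ.≤ count a ℕ.+ count b
count-∨ true  _ = s≤s z≤n
count-∨ false _ = ℕₚ.≤-refl

-- σ, τ: whether the head lies in p, q; a, A, B: whether the tail side meets p ∩ q, p, q.
cut-count : ∀ σ τ a A B → (T a → T A) → (T a → T B) →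
  count (not (σ ∧ τ) ∧ a) ℕ.+ count (not (σ ∨ τ) ∧ (A ∨ B)) ℕ.≤ count (not σ ∧ A) ℕ.+ count (not τ ∧ B)
cut-count true  true  _     _     _     _   _   = z≤n
cut-count true  false a     _     _     _   a⇒B = subst (ℕ._≤ _) (sym (ℕₚ.+-identityʳ (count a))) (count-mono a⇒B)
cut-count false true  _     _     _     a⇒A _   = ℕₚ.+-monoˡ-≤ 0 (count-mono a⇒A)
cut-count false false false A     B     _   _   = count-∨ A B
cut-count false false true  true  true  _   _   = ℕₚ.≤-refl
cut-count false false true  false _     a⇒A _   = ⊥-elim (a⇒A tt)
cut-count false false true  true  false _   a⇒B = ⊥-elim (a⇒B tt)

module _ {n} (p q : Subset n) where

  CountSubmodularAt : (Subset n → Bool) → Set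
  CountSubmodularAt χ = count (χ (p ∩ q)) ℕ.+ count (χ (p ∪ q)) ℕ.≤ count (χ p) ℕ.+ count (χ q)

  countSubmodularAt-resp : ∀ {χ ψ} → (∀ U → χ U ≡ ψ U) → CountSubmodularAt χ → CountSubmodularAt ψ
  countSubmodularAt-resp χ≡ψ =
    subst₂ ℕ._≤_ (cong₂ count₂ (χ≡ψ (p ∩ q)) (χ≡ψ (p ∪ q))) (cong₂ count₂ (χ≡ψ p) (χ≡ψ q))
    where
      count₂ : Bool → Bool → ℕ
      count₂ a b = count a ℕ.+ count b

  lookup-∩ : ∀ v → lookupᵛ (p ∩ q) v ≡ lookupᵛ p v ∧ lookupᵛ q v
  lookup-∩ v = lookup-zipWith _∧_ v p q

  lookup-∪ : ∀ v → lookupᵛ (p ∪ q) v ≡ lookupᵛ p v ∨ lookupᵛ q v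
  lookup-∪ v = lookup-zipWith _∨_ v p q

  leaves-countSubmodular : ∀ h (A : Subset n → Bool) →
    (T (A (p ∩ q)) → T (A p)) → (T (A (p ∩ q)) → T (A q)) → A (p ∪ q) ≡ A p ∨ A q →
    CountSubmodularAt (λ U → not (lookupᵛ U h) ∧ A U)
  leaves-countSubmodular h A ∩⇒p ∩⇒q ∪≡
    rewrite lookup-∩ h | lookup-∪ h | ∪≡ = cut-count (lookupᵛ p h) (lookupᵛ q h) _ _ _ ∩⇒p ∩⇒q

  T-lookup-∩ˡ : ∀ v → T (lookupᵛ (p ∩ q) v) → T (lookupᵛ p v)
  T-lookup-∩ˡ v = proj₁ ∘ Equivalence.to T-∧ ∘ subst T (lookup-∩ v)

  T-lookup-∩ʳ : ∀ v → T (lookupᵛ (p ∩ q) v) → T (lookupᵛ q v)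
  T-lookup-∩ʳ v = proj₂ ∘ Equivalence.to T-∧ ∘ subst T (lookup-∩ v)

  δ⁺-countSubmodular : ∀ t h → CountSubmodularAt (λ U → lookupᵛ U t ∧ not (lookupᵛ U h))
  δ⁺-countSubmodular t h =
    countSubmodularAt-resp (λ U → ∧-comm (not (lookupᵛ U h)) (lookupᵛ U t))
      (leaves-countSubmodular h (λ U → lookupᵛ U t) (T-lookup-∩ˡ t) (T-lookup-∩ʳ t) (lookup-∪ t))

  meets-∪ : ∀ φ → meets (p ∪ q) φ ≡ meets p φ ∨ meets q φ
  meets-∪ φ = trans (anyFin-cong n distrib) (anyFin-∨ n _ _)
    where
      distrib : ∀ v → lookupᵛ (p ∪ q) v ∧ φ v ≡ lookupᵛ p v ∧ φ v ∨ lookupᵛ q v ∧ φ v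
      distrib v = trans (cong (_∧ φ v) (lookup-∪ v)) (∧-distribʳ-∨ (φ v) (lookupᵛ p v) (lookupᵛ q v))

  Δ⁺-countSubmodular : ∀ s φ → CountSubmodularAt (λ U → not (lookupᵛ U s) ∧ meets U φ)
  Δ⁺-countSubmodular s φ =
    leaves-countSubmodular s (λ U → meets U φ)
      (anyFin-mono n (T-∧-monoˡ ∘ T-lookup-∩ˡ)) (anyFin-mono n (T-∧-monoˡ ∘ T-lookup-∩ʳ)) (meets-∪ φ)

module OrderedCommRingProperties {c ℓ₁ ℓ₂} (𝕆 : OrderedCommRing c ℓ₁ ℓ₂) where
  open OrderedCommRing 𝕆
    using (Carrier; _≈_; _≤_; _+_; -_; 0#; isTotalOrder; +-monoˡ-≤; +-comm; +-assoc; +-cong; +-congˡ;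
           +-identityʳ; -‿inverseʳ; +-commutativeSemigroup; +-monoid)
    renaming (refl to ≈-refl; sym to ≈-sym; trans to ≈-trans)
  open CommutativeSemigroupProperties +-commutativeSemigroup using (interchange)
  open MonoidMultProperties +-monoid using (×-homo-1; ×-homo-+) renaming (_×_ to _·_)

  poset : Poset c ℓ₁ ℓ₂
  poset = record { isPartialOrder = IsTotalOrder.isPartialOrder isTotalOrder }

  open Poset poset public using () renaming (reflexive to ≤-reflexive; antisym to ≤-antisym)
  open PosetReasoning poset

  +-monoʳ-≤ : ∀ {a b} d → a ≤ b → d + a ≤ d + b
  +-monoʳ-≤ {a} {b} d a≤b = begin
    d + a ≈⟨ +-comm d a ⟩
    a + d ≤⟨ +-monoˡ-≤ d a≤b ⟩
    b + d ≈⟨ +-comm b d ⟩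
    d + b ∎

  +-mono-≤ : ∀ {a b c d} → a ≤ b → c ≤ d → a + c ≤ b + d
  +-mono-≤ {a} {b} {c} {d} a≤b c≤d = begin
    a + c ≤⟨ +-monoˡ-≤ c a≤b ⟩
    b + c ≤⟨ +-monoʳ-≤ b c≤d ⟩
    b + d ∎

  +-cancelʳ-≤ : ∀ {a b} k → a + k ≤ b + k → a ≤ b
  +-cancelʳ-≤ {a} {b} k a+k≤b+k = begin
    a             ≈⟨ cancel a ⟨
    a + k + - k   ≤⟨ +-monoˡ-≤ (- k) a+k≤b+k ⟩
    b + k + - k   ≈⟨ cancel b ⟩
    b             ∎
    where
      cancel : ∀ a → a + k + - k ≈ a
      cancel a = ≈-trans (+-assoc a k (- k)) (≈-trans (+-congˡ (-‿inverseʳ k)) (+-identityʳ a))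

  +-squeeze : ∀ {a b c d k} → a + b ≤ c + d → c ≈ k → d ≈ k → k ≤ a → k ≤ b → a ≈ k × b ≈ k
  +-squeeze {a} {b} {c} {d} {k} a+b≤c+d c≈k d≈k k≤a k≤b =
    ≤-antisym (+-cancelʳ-≤ k a+k≤k+k) k≤a , ≤-antisym (+-cancelʳ-≤ k b+k≤k+k) k≤b
    where
      a+b≤k+k : a + b ≤ k + k
      a+b≤k+k = begin
        a + b ≤⟨ a+b≤c+d ⟩
        c + d ≈⟨ +-cong c≈k d≈k ⟩
        k + k ∎
      a+k≤k+k : a + k ≤ k + k
      a+k≤k+k = begin
        a + k ≤⟨ +-monoʳ-≤ a k≤b ⟩
        a + b ≤⟨ a+b≤k+k ⟩
        k + k ∎
      b+k≤k+k : b + k ≤ k + k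
      b+k≤k+k = begin
        b + k ≈⟨ +-comm b k ⟩
        k + b ≤⟨ +-monoˡ-≤ b k≤a ⟩
        a + b ≤⟨ a+b≤k+k ⟩
        k + k ∎

  ·-nonneg : ∀ n {z} → 0# ≤ z → 0# ≤ n · z
  ·-nonneg zero    _   = ≤-reflexive ≈-refl
  ·-nonneg (suc n) {z} 0≤z = begin
    0#          ≈⟨ +-identityʳ 0# ⟨
    0# + 0#     ≤⟨ +-mono-≤ 0≤z (·-nonneg n 0≤z) ⟩
    z + n · z   ∎

  ·-monoˡ-≤ : ∀ {m n z} → m ℕ.≤ n → 0# ≤ z → m · z ≤ n · z
  ·-monoˡ-≤ {n = n} z≤n       0≤z = ·-nonneg n 0≤z
  ·-monoˡ-≤ {z = z} (s≤s m≤n) 0≤z = +-monoʳ-≤ z (·-monoˡ-≤ m≤n 0≤z)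

  if≈count· : ∀ b z → (if b then z else 0#) ≈ count b · z
  if≈count· true  z = ≈-sym (×-homo-1 z)
  if≈count· false z = ≈-refl

  module _ {n} (p q : Subset n) where

    SubmodularAt : (Subset n → Carrier) → Set ℓ₂
    SubmodularAt f = f (p ∩ q) + f (p ∪ q) ≤ f p + f q

    +-submodularAt : ∀ {f g} → SubmodularAt f → SubmodularAt g → SubmodularAt (λ U → f U + g U)
    +-submodularAt {f} {g} f-sub g-sub = begin
      (f (p ∩ q) + g (p ∩ q)) + (f (p ∪ q) + g (p ∪ q)) ≈⟨ interchange _ _ _ _ ⟩
      (f (p ∩ q) + f (p ∪ q)) + (g (p ∩ q) + g (p ∪ q)) ≤⟨ +-mono-≤ f-sub g-sub ⟩
      (f p + f q) + (g p + g q)                         ≈⟨ interchange _ _ _ _ ⟩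
      (f p + g p) + (f q + g q)                         ∎

    sumFin-submodularAt : ∀ k (f : Fin k → Subset n → Carrier) → (∀ i → SubmodularAt (f i)) →
                          SubmodularAt (λ U → sumFin 𝕆 k (λ i → f i U))
    sumFin-submodularAt zero    f f-sub = ≤-reflexive ≈-refl
    sumFin-submodularAt (suc k) f f-sub =
      +-submodularAt (f-sub zero) (sumFin-submodularAt k (f ∘ suc) (f-sub ∘ suc))

    sumSubset-submodularAt : ∀ k (f : Subset k → Subset n → Carrier) → (∀ F → SubmodularAt (f F)) →
                             SubmodularAt (λ U → sumSubset 𝕆 k (λ F → f F U))
    sumSubset-submodularAt zero    f f-sub = f-sub _
    sumSubset-submodularAt (suc k) f f-sub =
      +-submodularAt (sumSubset-submodularAt k (f ∘ (false ∷_)) (f-sub ∘ (false ∷_)))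
                     (sumSubset-submodularAt k (f ∘ (true ∷_))  (f-sub ∘ (true ∷_)))

    if-submodularAt : ∀ {χ z} → 0# ≤ z → CountSubmodularAt p q χ →
                      SubmodularAt (λ U → if χ U then z else 0#)
    if-submodularAt {χ} {z} 0≤z χ-sub = begin
      ind (p ∩ q) + ind (p ∪ q)            ≈⟨ +-cong (if≈count· _ z) (if≈count· _ z) ⟩
      nχ (p ∩ q) · z + nχ (p ∪ q) · z      ≈⟨ ×-homo-+ z (nχ (p ∩ q)) (nχ (p ∪ q)) ⟨
      (nχ (p ∩ q) ℕ.+ nχ (p ∪ q)) · z      ≤⟨ ·-monoˡ-≤ χ-sub 0≤z ⟩
      (nχ p ℕ.+ nχ q) · z                  ≈⟨ ×-homo-+ z (nχ p) (nχ q) ⟩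
      nχ p · z + nχ q · z                  ≈⟨ +-cong (if≈count· _ z) (if≈count· _ z) ⟨
      ind p + ind q                        ∎
      where
        ind : Subset n → Carrier
        ind U = if χ U then z else 0#
        nχ : Subset n → ℕ
        nχ U = count (χ U)

module _ {n m : ℕ} (ends : Graph n m) (R : Subset n) (r : Fin n) (p q : Subset n) where

  valid-∩ : Nonempty (p ∩ q ∩ R) → r ∉ p → Valid ends R r (p ∩ q)
  valid-∩ (v , v∈p∩q∩R) r∉p = (v , subst (v ∈_) (sym (∩-assoc p q R)) v∈p∩q∩R) , r∉p ∘ p∩q⊆p p q

  valid-∪ : Valid ends R r p → Valid ends R r q → Valid ends R r (p ∪ q)
  valid-∪ ((v , v∈p∩R) , r∉p) (_ , r∉q) =
    (v , x∈p∩q⁺ (p⊆p∪q q (proj₁ v∈p∧R) , proj₂ v∈p∧R)) , [ r∉p , r∉q ] ∘ x∈p∪q⁻ p q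
    where
      v∈p∧R : _ ∈ p × _ ∈ R
      v∈p∧R = x∈p∩q⁻ p R v∈p∩R

module Cuts {c ℓ₁ ℓ₂} (𝕆 : OrderedCommRing c ℓ₁ ℓ₂) {n m : ℕ} (ends : Graph n m) (R : Subset n) (r : Fin n)
            (x : Arc m → OrderedCommRing.Carrier 𝕆) (y : Subset m → Fin n → OrderedCommRing.Carrier 𝕆) where
  open OrderedCommRing 𝕆 using (_≤_; 0#) renaming (sym to ≈-sym)
  open OrderedCommRingProperties 𝕆

  InI⇒y≥0 : InI 𝕆 ends R r x y → ∀ F s → 0# ≤ y F s
  InI⇒y≥0 (_ , dfc⇒y≥0 , ¬dfc⇒y≈0 , _) F s with Decidability.isDFC? ends R F s
  ... | yes dfc  = dfc⇒y≥0 F s dfc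
  ... | no  ¬dfc = ≤-reflexive (≈-sym (¬dfc⇒y≈0 F s ¬dfc))

  module _ (p q : Subset n) where

    xδ⁺-submodularAt : (∀ a → 0# ≤ x a) → SubmodularAt p q (xδ⁺ 𝕆 ends R r x y)
    xδ⁺-submodularAt x≥0 =
      sumFin-submodularAt p q m _ λ e → +-submodularAt p q (arc (e , true)) (arc (e , false))
      where
        arc : ∀ a → SubmodularAt p q (λ U → if lookupᵛ U (tail ends a) ∧ not (lookupᵛ U (head ends a))
                                            then x a else 0#)
        arc a = if-submodularAt p q (x≥0 a) (δ⁺-countSubmodular p q (tail ends a) (head ends a))

    -- inΔ⁺ ends R U F s unfolds to  not (lookup U s) ∧ meets U φ,  with φ v saying v is a source of (F , s).
    yΔ⁺-submodularAt : (∀ F s → 0# ≤ y F s) → SubmodularAt p q (yΔ⁺ 𝕆 ends R r x y)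
    yΔ⁺-submodularAt y≥0 =
      sumSubset-submodularAt p q m _ λ F → sumFin-submodularAt p q n _ λ s →
        if-submodularAt p q (y≥0 F s) (Δ⁺-countSubmodular p q s _)

lemma5 : ∀ {c ℓ₁ ℓ₂} (𝕆 : OrderedCommRing c ℓ₁ ℓ₂) {n m : ℕ}
           (ends : Graph n m) (R : Subset n) (r : Fin n) → r ∈ R →
           (x : Arc m → OrderedCommRing.Carrier 𝕆)
           (y : Subset m → Fin n → OrderedCommRing.Carrier 𝕆) →
           InI 𝕆 ends R r x y →
           (S T : Subset n) →
           TightValid 𝕆 ends R r x y S → TightValid 𝕆 ends R r x y T →
           Nonempty (S ∩ T ∩ R) →
           TightValid 𝕆 ends R r x y (S ∩ T) × TightValid 𝕆 ends R r x y (S ∪ T)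
lemma5 𝕆 ends R r _ x y xy∈I@(x≥0 , _ , _ , valid⇒≥1) S T
       (S-valid@(_ , r∉S) , S-tight) (T-valid , T-tight) S∩T∩R-nonempty =
  (S∩T-valid , proj₁ both-tight) , (S∪T-valid , proj₂ both-tight)
  where
    open OrderedCommRing 𝕆 using (Carrier; _+_; _≈_; 1#)
    open OrderedCommRingProperties 𝕆
    open Cuts 𝕆 ends R r x y

    f : Subset _ → Carrier
    f U = xδ⁺ 𝕆 ends R r x y U + yΔ⁺ 𝕆 ends R r x y U

    f-submodular : SubmodularAt S T f
    f-submodular = +-submodularAt S T (xδ⁺-submodularAt S T x≥0) (yΔ⁺-submodularAt S T (InI⇒y≥0 xy∈I))

    S∩T-valid : Valid ends R r (S ∩ T)
    S∩T-valid = valid-∩ ends R r S T S∩T∩R-nonempty r∉S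

    S∪T-valid : Valid ends R r (S ∪ T)
    S∪T-valid = valid-∪ ends R r S T S-valid T-valid

    both-tight : f (S ∩ T) ≈ 1# × f (S ∪ T) ≈ 1#
    both-tight = +-squeeze f-submodular S-tight T-tight (valid⇒≥1 _ S∩T-valid) (valid⇒≥1 _ S∪T-valid)
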